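{- There exists a language $L$ over the alphabet $\{0,1\}$ such that $L\in\mathrm{L}\cap\mathrm{CFL}/n$, $L$ is p-dense, and $L$ is $\mathrm{REG}$-immune.
   Context: $\mathrm{L}$ is the family of languages decidable by deterministic Turing machines with a read-only input tape and logarithmic-space work tape; $\mathrm{REG}$, $\mathrm{CFL}$ are the regular and context-free languages. $\mathrm{CFL}/n$ is the family of languages $L$ over $\Sigma$ for which there exist an alphabet $\Gamma$, $h:\mathbb{N}\to\Gamma^*$ with $|h(n)|=n$, and a context-free language $A$ over $\Sigma\times\Gamma$ with $x\in L$ iff $\left[\begin{smallmatrix}x\\ h(|x|)\end{smallmatrix}\right]\in A$ for all $x\in\Sigma^*$, where $\left[\begin{smallmatrix}x_1\cdots x_n\\ y_1\cdots y_n\end{smallmatrix}\right]=(x_1,y_1)\cdots(x_n,y_n)$. A language $L$ over $\Sigma$ is p-dense if there exist $n_0\in\mathbb{N}$ and a non-zero polynomial $p$ such that $|L\cap\Sigma^n|\ge|\Sigma^n|/p(n)$ for all $n\ge n_0$. $L$ is $\mathrm{REG}$-immune if $L$ is infinite and has no infinite regular subset. -}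

module Defs where

open import Data.Nat using (ℕ; zero; suc; _+_; _*_; _∸_; _^_; _≤_; _<ᵇ_; _≡ᵇ_; _⊓_)
open import Data.Nat.Logarithm using (⌊log₂_⌋)
open import Data.Bool using (Bool; true; false; if_then_else_)
open import Data.Fin using (Fin)
open import Data.List using (List; []; _∷_; length; map; _++_; zip)
open import Data.Nat.ListAction using (sum)
open import Data.List.Membership.Propositional using (_∈_)
open import Data.List.Relation.Unary.Any using (Any)
open import Data.Product using (Σ; ∃; _×_; _,_)
open import Data.Sum using (_⊎_; inj₁; inj₂)
open import Function.Bundles using (_⇔_)
open import Relation.Binary.PropositionalEquality using (_≡_)
open import Relation.Nullary using (¬_)

-- Languages over {0,1}: words are List Bool (false = 0, true = 1).
-- A language given as a predicate: List Bool → Set.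

Infinite : {A : Set} → (List A → Set) → Set
Infinite P = ∀ n → ∃ λ w → (n ≤ length w) × P w

record DFA (A : Set) : Set where
  field
    Q      : ℕ
    start  : Fin Q
    δ      : Fin Q → A → Fin Q
    accept : Fin Q → Bool

runDFA : {A : Set} → (M : DFA A) → Fin (DFA.Q M) → List A → Fin (DFA.Q M)
runDFA M q []       = q
runDFA M q (a ∷ as) = runDFA M (DFA.δ M q a) as

DFAaccepts : {A : Set} → DFA A → List A → Bool
DFAaccepts M w = DFA.accept M (runDFA M (DFA.start M) w)

Regular : {A : Set} → (List A → Set) → Set
Regular {A} P = Σ (DFA A) λ M → ∀ w → P w ⇔ (DFAaccepts M w ≡ true)

REGImmune : (List Bool → Set) → Set₁
REGImmune P = Infinite P ×
  ((R : List Bool → Set) → Regular R → (∀ w → R w → P w) → ¬ Infinite R)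

record CFG (T : Set) : Set where
  field
    N     : ℕ
    start : Fin N
    rules : List (Fin N × List (Fin N ⊎ T))

data DerivesSeq {T : Set} (G : CFG T) : List (Fin (CFG.N G) ⊎ T) → List T → Set where
  []      : DerivesSeq G [] []
  term    : ∀ {α w} (t : T) → DerivesSeq G α w → DerivesSeq G (inj₂ t ∷ α) (t ∷ w)
  nonterm : ∀ {X β α u v} → (X , β) ∈ CFG.rules G →
            DerivesSeq G β u → DerivesSeq G α v → DerivesSeq G (inj₁ X ∷ α) (u ++ v)

Generates : {T : Set} → CFG T → List T → Set
Generates G w = DerivesSeq G (inj₁ (CFG.start G) ∷ []) w

ContextFree : {T : Set} → (List T → Set) → Set
ContextFree {T} P = Σ (CFG T) λ G → ∀ w → P w ⇔ Generates G w

-- CFL/n: advice h(n) of length n over an alphabet Γ = Fin k, and a CFL A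
-- over Σ × Γ such that x ∈ L iff [x ; h(|x|)] ∈ A.
InCFLn : (List Bool → Set) → Set₁
InCFLn P = Σ ℕ λ k → Σ (ℕ → List (Fin k)) λ h → (∀ n → length (h n) ≡ n) ×
  Σ (List (Bool × Fin k) → Set) λ A → ContextFree A ×
    (∀ x → P x ⇔ A (zip x (h (length x))))

-- Deterministic Turing machines with a read-only input tape (with
-- endmarkers, head confined to positions 0..n+1) and one work tape
-- (infinite to the right, blank = Fin.zero).

data InSym : Set where
  lend rend : InSym
  sym       : Bool → InSym

data Move : Set where
  left stay right : Move

data Action (Q Γ : ℕ) : Set where
  halt : Bool → Action Q Γ
  go   : Fin Q → Fin (suc Γ) → Move → Move → Action Q Γ      -- new state, written symbol, input move, work move

record TM : Set where
  field
    Q     : ℕ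
    Γ     : ℕ
    start : Fin Q
    δ     : Fin Q → InSym → Fin (suc Γ) → Action Q Γ

record Config (Q Γ : ℕ) : Set where
  constructor config
  field
    state : Fin Q
    ipos  : ℕ
    tape  : ℕ → Fin (suc Γ)
    wpos  : ℕ

-- symbol at input position i (0 = left endmarker, 1..n = input, n+1 = right endmarker)
readIn : List Bool → ℕ → InSym
readIn w zero = lend
readIn w (suc i) = go' w i
  where
  go' : List Bool → ℕ → InSym
  go' []       _       = rend
  go' (b ∷ _)  zero    = sym b
  go' (_ ∷ bs) (suc j) = go' bs j

moveIn : ℕ → Move → ℕ → ℕ
moveIn n left  i = i ∸ 1
moveIn n stay  i = i
moveIn n right i = suc i ⊓ suc n

moveW : Move → ℕ → ℕ
moveW left  i = i ∸ 1
moveW stay  i = i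
moveW right i = suc i

step : (M : TM) → List Bool → Config (TM.Q M) (TM.Γ M) → Config (TM.Q M) (TM.Γ M) ⊎ Bool
step M w (config q i t p) with TM.δ M q (readIn w i) (t p)
... | halt b = inj₂ b
... | go q' s mi mw =
  inj₁ (config q' (moveIn (length w) mi i)
               (λ j → if j ≡ᵇ p then s else t j)
               (moveW mw p))

run : (M : TM) → List Bool → ℕ → Config (TM.Q M) (TM.Γ M) ⊎ Bool → Config (TM.Q M) (TM.Γ M) ⊎ Bool
run M w zero    x        = x
run M w (suc n) (inj₁ c) = run M w n (step M w c)
run M w (suc n) (inj₂ b) = inj₂ b

initConfig : (M : TM) → Config (TM.Q M) (TM.Γ M)
initConfig M = config (TM.start M) 0 (λ _ → Fin.zero) 0

DecidesInLogSpace : TM → (List Bool → Bool) → Set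
DecidesInLogSpace M L =
  (∀ w → ∃ λ t → run M w t (inj₁ (initConfig M)) ≡ inj₂ (L w)) ×
  (∃ λ c → ∀ w t cfg → run M w t (inj₁ (initConfig M)) ≡ inj₁ cfg →
           Config.wpos cfg ≤ c * ⌊log₂ (length w) ⌋ + c)

InLOGSPACE : (List Bool → Bool) → Set
InLOGSPACE L = Σ TM λ M → DecidesInLogSpace M L

words : ℕ → List (List Bool)
words zero    = [] ∷ []
words (suc n) = map (false ∷_) (words n) ++ map (true ∷_) (words n)

countLen : (List Bool → Bool) → ℕ → ℕ
countLen L n = sum (map (λ w → if L w then 1 else 0) (words n))

-- polynomials with natural coefficients, constant term first
Poly : Set
Poly = List ℕ

evalPoly : Poly → ℕ → ℕ
evalPoly []       x = 0
evalPoly (a ∷ as) x = a + x * evalPoly as x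

NonZeroPoly : Poly → Set
NonZeroPoly p = Any (λ a → ¬ a ≡ 0) p

-- |L ∩ Σ^n| ≥ |Σ^n| / p(n), written multiplicatively.
PDense : (List Bool → Bool) → Set
PDense L = ∃ λ n₀ → ∃ λ p → NonZeroPoly p ×
  (∀ n → n₀ ≤ n → 2 ^ n ≤ countLen L n * evalPoly p n)

-- L consists of the words 1ᵏ0v whose length n has bit length k.  A Turing machine decides L
-- in logarithmic space by writing n in binary on its work tape and matching the digits of
-- that counter against the leading ones of the input.  Given the advice 1ᵏ0⋆⋯⋆ for length n,
-- what remains to check is regular, hence context free.  Exactly 2ⁿ⁻ᵏ⁻¹ ≥ 2ⁿ/4n words of
-- length n ≥ 3 lie in L.  Finally, if a DFA accepts only words of L and accepts some 1ᵏ0v with k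
-- at least its number of states, then it also accepts 1ᵏ⁺ᵘ0v for every multiple u of the
-- length of a loop it runs on 1ᵏ; for u ≥ max(3, |1ᵏ0v|) the bit length of |1ᵏ0v| + u is at
-- most u < k + u, so 1ᵏ⁺ᵘ0v ∉ L.
module Submission where

open import Defs
open import Data.Bool using (Bool; true; false; if_then_else_; T)
open import Data.Empty using (⊥-elim)
open import Data.Fin using (Fin; zero; suc; toℕ)
open import Data.Fin.Properties using (pigeonhole; toℕ<n)
open import Data.List using (List; []; _∷_; length; map; replicate; _++_; zip; drop)
open import Data.List.Properties using (length-replicate; map-++; map-∘; ++-identityʳ)
open import Data.List.Relation.Unary.Any using (here; there)
open import Data.List.Membership.Propositional using (_∈_)
open import Data.Nat
open import Data.Nat.ListAction using (sum)
open import Data.Nat.ListAction.Properties using (sum-++)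
open import Data.Nat.Logarithm
  using (⌊log₂_⌋; ⌊log₂⌋-mono-≤; ⌊log₂[2^n]⌋≡n; ⌊log₂[2*b]⌋≡1+⌊log₂b⌋)
open import Data.Nat.Properties
open import Data.Nat.Tactic.RingSolver using (solve-∀)
open import Data.Product using (Σ; ∃; ∃₂; _×_; _,_)
open import Data.Sum using (inj₁; inj₂)
open import Data.Unit using (⊤; tt)
open import Function.Base using (_∘_)
open import Function.Bundles using (mk⇔; Equivalence)
open import Relation.Binary.PropositionalEquality as ≡
  using (_≡_; _≢_; refl; cong; cong₂; subst; trans; module ≡-Reasoning)
open import Relation.Nullary using (¬_)

-- Binary counters

increment : List Bool → List Bool
increment []           = true ∷ []
increment (false ∷ ds) = true ∷ ds
increment (true ∷ ds)  = false ∷ increment ds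

binary : ℕ → List Bool
binary zero    = []
binary (suc n) = increment (binary n)

bitLength : ℕ → ℕ
bitLength n = length (binary n)

value : List Bool → ℕ
value []       = 0
value (b ∷ ds) = (if b then 1 else 0) + 2 * value ds

value-increment : ∀ ds → value (increment ds) ≡ suc (value ds)
value-increment []           = refl
value-increment (false ∷ ds) = refl
value-increment (true ∷ ds)  = begin
  2 * value (increment ds) ≡⟨ cong (2 *_) (value-increment ds) ⟩
  2 * suc (value ds)       ≡⟨ *-suc 2 (value ds) ⟩
  suc (1 + 2 * value ds)   ∎
  where open ≡-Reasoning

value-binary : ∀ n → value (binary n) ≡ n
value-binary zero    = refl
value-binary (suc n) = trans (value-increment (binary n)) (cong suc (value-binary n))

length-increment : ∀ ds → length ds ≤ length (increment ds)
length-increment []           = z≤n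
length-increment (false ∷ ds) = ≤-refl
length-increment (true ∷ ds)  = s≤s (length-increment ds)

increment-replicate-++ : ∀ j rest →
  increment (replicate j true ++ rest) ≡ replicate j false ++ increment rest
increment-replicate-++ zero    rest = refl
increment-replicate-++ (suc j) rest = cong (false ∷_) (increment-replicate-++ j rest)

bitLength-mono : ∀ {m n} → m ≤ n → bitLength m ≤ bitLength n
bitLength-mono {m} m≤n = mono (≤⇒≤′ m≤n)
  where
  mono : ∀ {n} → m ≤′ n → bitLength m ≤ bitLength n
  mono ≤′-refl            = ≤-refl
  mono (≤′-step {n} m≤′n) = ≤-trans (mono m≤′n) (length-increment (binary n))

value<2^length : ∀ ds → value ds < 2 ^ length ds
value<2^length []       = s≤s z≤n
value<2^length (b ∷ ds) = ≤-trans (+-monoˡ-≤ (2 * value ds) (bit<2 b)) (begin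
  2 + 2 * value ds   ≡⟨ *-suc 2 (value ds) ⟨
  2 * suc (value ds) ≤⟨ *-monoʳ-≤ 2 (value<2^length ds) ⟩
  2 * 2 ^ length ds  ∎)
  where
  open ≤-Reasoning
  bit<2 : ∀ b → (if b then 1 else 0) < 2
  bit<2 false = s≤s z≤n
  bit<2 true  = ≤-refl

n<2^bitLength : ∀ n → n < 2 ^ bitLength n
n<2^bitLength n = subst (_< 2 ^ bitLength n) (value-binary n) (value<2^length (binary n))

-- Little-endian: the most significant digit is the last one.
NoLeadingZero : List Bool → Set
NoLeadingZero []           = ⊤
NoLeadingZero (b ∷ [])     = b ≡ true
NoLeadingZero (_ ∷ c ∷ ds) = NoLeadingZero (c ∷ ds)

noLeadingZero-increment : ∀ ds → NoLeadingZero ds → NoLeadingZero (increment ds)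
noLeadingZero-increment []                  _  = refl
noLeadingZero-increment (false ∷ [])        ()
noLeadingZero-increment (false ∷ c ∷ ds)    nz = nz
noLeadingZero-increment (true ∷ [])         _  = refl
noLeadingZero-increment (true ∷ false ∷ ds) nz = noLeadingZero-increment (false ∷ ds) nz
noLeadingZero-increment (true ∷ true ∷ ds)  nz = noLeadingZero-increment (true ∷ ds) nz

noLeadingZero-binary : ∀ n → NoLeadingZero (binary n)
noLeadingZero-binary zero    = tt
noLeadingZero-binary (suc n) = noLeadingZero-increment (binary n) (noLeadingZero-binary n)

2^length≤2*value : ∀ b ds → NoLeadingZero (b ∷ ds) → 2 ^ length (b ∷ ds) ≤ 2 * value (b ∷ ds)
2^length≤2*value b []       refl = ≤-refl
2^length≤2*value b (c ∷ ds) nz   = *-monoʳ-≤ 2 (begin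
  2 ^ length (c ∷ ds)  ≤⟨ 2^length≤2*value c ds nz ⟩
  2 * value (c ∷ ds)   ≤⟨ m≤n+m _ (if b then 1 else 0) ⟩
  value (b ∷ c ∷ ds)   ∎)
  where open ≤-Reasoning

2^bitLength≤2*n : ∀ n .{{_ : NonZero n}} → 2 ^ bitLength n ≤ 2 * n
2^bitLength≤2*n (suc n)
  with increment (binary n) | noLeadingZero-binary (suc n) | value-binary (suc n)
... | b ∷ ds | nz | value≡ =
  subst (λ m → 2 ^ length (b ∷ ds) ≤ 2 * m) value≡ (2^length≤2*value b ds nz)

2^k≤n⇒k<bitLength : ∀ {k n} → 2 ^ k ≤ n → k < bitLength n
2^k≤n⇒k<bitLength {k} {n} 2^k≤n = ≰⇒> λ bitLength≤k →
  <⇒≱ (<-≤-trans (n<2^bitLength n) (^-monoʳ-≤ 2 bitLength≤k)) 2^k≤n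

n<2^k⇒bitLength≤k : ∀ {k n} → n < 2 ^ k → bitLength n ≤ k
n<2^k⇒bitLength≤k {k} {zero}      _     = z≤n
n<2^k⇒bitLength≤k {k} {n@(suc _)} n<2^k = ≮⇒≥ λ k<bitLength →
  <⇒≱ n<2^k (*-cancelˡ-≤ 2 (≤-trans (^-monoʳ-≤ 2 k<bitLength) (2^bitLength≤2*n n)))

bitLength≤1+⌊log₂⌋ : ∀ n → bitLength n ≤ 1 + ⌊log₂ n ⌋
bitLength≤1+⌊log₂⌋ zero      = z≤n
bitLength≤1+⌊log₂⌋ n@(suc _) = begin
  bitLength n               ≡⟨ ⌊log₂[2^n]⌋≡n (bitLength n) ⟨
  ⌊log₂ (2 ^ bitLength n) ⌋ ≤⟨ ⌊log₂⌋-mono-≤ (2^bitLength≤2*n n) ⟩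
  ⌊log₂ (2 * n) ⌋           ≡⟨ ⌊log₂[2*b]⌋≡1+⌊log₂b⌋ n ⟩
  1 + ⌊log₂ n ⌋             ∎
  where open ≤-Reasoning

1+bitLength≤2*⌊log₂⌋+2 : ∀ n → suc (bitLength n) ≤ 2 * ⌊log₂ n ⌋ + 2
1+bitLength≤2*⌊log₂⌋+2 n = begin
  suc (bitLength n)   ≤⟨ s≤s (bitLength≤1+⌊log₂⌋ n) ⟩
  2 + ⌊log₂ n ⌋       ≡⟨ +-comm 2 ⌊log₂ n ⌋ ⟩
  ⌊log₂ n ⌋ + 2       ≤⟨ +-monoˡ-≤ 2 (m≤n*m ⌊log₂ n ⌋ 2) ⟩
  2 * ⌊log₂ n ⌋ + 2   ∎
  where open ≤-Reasoning

2*n<2^n : ∀ n → 3 ≤ n → 2 * n < 2 ^ n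
2*n<2^n 1 (s≤s ())
2*n<2^n 2 (s≤s (s≤s ()))
2*n<2^n 3 _ = s≤s (s≤s (s≤s (s≤s (s≤s (s≤s (s≤s z≤n))))))
2*n<2^n (suc n@(suc (suc (suc _)))) _ = begin-strict
  2 * suc n       ≡⟨ *-suc 2 n ⟩
  2 + 2 * n       <⟨ +-monoʳ-< 2 (2*n<2^n n (s≤s (s≤s (s≤s z≤n)))) ⟩
  2 + 2 ^ n       ≤⟨ +-monoˡ-≤ (2 ^ n) (^-monoʳ-≤ 2 {1} {n} (s≤s z≤n)) ⟩
  2 ^ n + 2 ^ n   ≡⟨ cong (2 ^ n +_) (+-identityʳ (2 ^ n)) ⟨
  2 ^ suc n       ∎
  where open ≤-Reasoning

bitLength<n : ∀ n → 3 ≤ n → bitLength n < n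
bitLength<n n@(suc m) 3≤n =
  s≤s (n<2^k⇒bitLength≤k (*-cancelˡ-< 2 n (2 ^ m) (2*n<2^n n 3≤n)))

bitLength[n+u]≤u : ∀ n u → 3 ≤ u → n ≤ u → bitLength (n + u) ≤ u
bitLength[n+u]≤u n u 3≤u n≤u = n<2^k⇒bitLength≤k (begin-strict
  n + u       ≤⟨ +-monoˡ-≤ u n≤u ⟩
  u + u       ≡⟨ cong (u +_) (+-identityʳ u) ⟨
  2 * u       <⟨ 2*n<2^n u 3≤u ⟩
  2 ^ u       ∎)
  where open ≤-Reasoning

countLen-suc : ∀ f m →
  countLen f (suc m) ≡ countLen (λ w → f (false ∷ w)) m + countLen (λ w → f (true ∷ w)) m
countLen-suc f m = begin
  sum (map χ (map (false ∷_) ws ++ map (true ∷_) ws))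
    ≡⟨ cong sum (map-++ χ (map (false ∷_) ws) (map (true ∷_) ws)) ⟩
  sum (map χ (map (false ∷_) ws) ++ map χ (map (true ∷_) ws))
    ≡⟨ sum-++ (map χ (map (false ∷_) ws)) _ ⟩
  sum (map χ (map (false ∷_) ws)) + sum (map χ (map (true ∷_) ws))
    ≡⟨ cong₂ _+_ (cong sum (map-∘ ws)) (cong sum (map-∘ ws)) ⟨
  countLen (λ w → f (false ∷ w)) m + countLen (λ w → f (true ∷ w)) m ∎
  where
  open ≡-Reasoning
  ws = words m
  χ : List Bool → ℕ
  χ w = if f w then 1 else 0

countLen-cong : ∀ m {f g} → (∀ w → length w ≡ m → f w ≡ g w) → countLen f m ≡ countLen g m
countLen-cong zero          f≗g = cong (λ b → (if b then 1 else 0) + 0) (f≗g [] refl)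
countLen-cong (suc m) {f} {g} f≗g = begin
  countLen f (suc m)
    ≡⟨ countLen-suc f m ⟩
  countLen (λ w → f (false ∷ w)) m + countLen (λ w → f (true ∷ w)) m
    ≡⟨ cong₂ _+_ (countLen-cong m λ w p → f≗g (false ∷ w) (cong suc p))
                 (countLen-cong m λ w p → f≗g (true ∷ w) (cong suc p)) ⟩
  countLen (λ w → g (false ∷ w)) m + countLen (λ w → g (true ∷ w)) m
    ≡⟨ countLen-suc g m ⟨
  countLen g (suc m) ∎
  where open ≡-Reasoning

countLen-true : ∀ m → countLen (λ _ → true) m ≡ 2 ^ m
countLen-true zero    = refl
countLen-true (suc m) = begin
  countLen (λ _ → true) (suc m)
    ≡⟨ countLen-suc _ m ⟩
  countLen (λ _ → true) m + countLen (λ _ → true) m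
    ≡⟨ cong₂ _+_ (countLen-true m) (countLen-true m) ⟩
  2 ^ m + 2 ^ m
    ≡⟨ cong (2 ^ m +_) (+-identityʳ (2 ^ m)) ⟨
  2 ^ suc m ∎
  where open ≡-Reasoning

countLen-false : ∀ m → countLen (λ _ → false) m ≡ 0
countLen-false zero    = refl
countLen-false (suc m) =
  trans (countLen-suc _ m) (cong₂ _+_ (countLen-false m) (countLen-false m))

-- Pumping in a DFA

module _ {A : Set} (D : DFA A) where
  open DFA D

  runDFA-++ : ∀ q xs ys → runDFA D q (xs ++ ys) ≡ runDFA D (runDFA D q xs) ys
  runDFA-++ q []       ys = refl
  runDFA-++ q (x ∷ xs) ys = runDFA-++ (δ q x) xs ys

  runDFA-replicate-+ : ∀ x q m n →
    runDFA D q (replicate (m + n) x) ≡ runDFA D (runDFA D q (replicate m x)) (replicate n x)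
  runDFA-replicate-+ x q zero    n = refl
  runDFA-replicate-+ x q (suc m) n = runDFA-replicate-+ x (δ q x) m n

  runDFA-replicate-loop : ∀ x p n → runDFA D p (replicate n x) ≡ p →
    ∀ t → runDFA D p (replicate (t * n) x) ≡ p
  runDFA-replicate-loop x p n loop zero    = refl
  runDFA-replicate-loop x p n loop (suc t) = begin
    runDFA D p (replicate (n + t * n) x)
      ≡⟨ runDFA-replicate-+ x p n (t * n) ⟩
    runDFA D (runDFA D p (replicate n x)) (replicate (t * n) x)
      ≡⟨ cong (λ q → runDFA D q (replicate (t * n) x)) loop ⟩
    runDFA D p (replicate (t * n) x)
      ≡⟨ runDFA-replicate-loop x p n loop t ⟩
    p ∎
    where open ≡-Reasoning

  runDFA-replicate-cycle : ∀ x q → ∃₂ λ a d → a ≤ Q ×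
    runDFA D (runDFA D q (replicate a x)) (replicate (suc d) x) ≡ runDFA D q (replicate a x)
  runDFA-replicate-cycle x q
    with i , j , i<j , same ← pigeonhole (n<1+n Q) (λ i → runDFA D q (replicate (toℕ i) x))
    with d , i+1+d≡j ← m≤n⇒∃[o]m+o≡n i<j
    = toℕ i , d , ≤-pred (<-trans i<j (toℕ<n j)) , ≡.sym (begin
      runDFA D q (replicate (toℕ i) x)
        ≡⟨ same ⟩
      runDFA D q (replicate (toℕ j) x)
        ≡⟨ cong (λ l → runDFA D q (replicate l x)) (≡.sym (trans (+-suc (toℕ i) d) i+1+d≡j)) ⟩
      runDFA D q (replicate (toℕ i + suc d) x)
        ≡⟨ runDFA-replicate-+ x q (toℕ i) (suc d) ⟩
      runDFA D (runDFA D q (replicate (toℕ i) x)) (replicate (suc d) x) ∎)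
    where open ≡-Reasoning

  runDFA-pump : ∀ x q → ∃ λ d → ∀ b t → Q ≤ b →
    runDFA D q (replicate (b + t * suc d) x) ≡ runDFA D q (replicate b x)
  runDFA-pump x q with a , d , a≤Q , loop ← runDFA-replicate-cycle x q = d , pump
    where
    p = runDFA D q (replicate a x)
    pump : ∀ b t → Q ≤ b → runDFA D q (replicate (b + t * suc d) x) ≡ runDFA D q (replicate b x)
    pump b t Q≤b with c , refl ← m≤n⇒∃[o]m+o≡n (≤-trans a≤Q Q≤b) = begin
      runDFA D q (replicate (a + c + u) x)
        ≡⟨ cong (λ l → runDFA D q (replicate l x)) (trans (+-assoc a c u) (cong (a +_) (+-comm c u))) ⟩
      runDFA D q (replicate (a + (u + c)) x)
        ≡⟨ runDFA-replicate-+ x q a (u + c) ⟩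
      runDFA D p (replicate (u + c) x)
        ≡⟨ runDFA-replicate-+ x p u c ⟩
      runDFA D (runDFA D p (replicate u x)) (replicate c x)
        ≡⟨ cong (λ r → runDFA D r (replicate c x)) (runDFA-replicate-loop x p (suc d) loop t) ⟩
      runDFA D p (replicate c x)
        ≡⟨ runDFA-replicate-+ x q a c ⟨
      runDFA D q (replicate (a + c) x) ∎
      where
      open ≡-Reasoning
      u = t * suc d

-- Runs of Turing machines

write : {A : Set} → ℕ → A → (ℕ → A) → ℕ → A
write p s t j = if j ≡ᵇ p then s else t j

write-same : ∀ {A : Set} {t : ℕ → A} p {s} → t p ≡ s → ∀ j → write p s t j ≡ t j
write-same {t = t} p tp≡s j with j ≡ᵇ p in j≡ᵇp
... | false = refl
... | true  = trans (≡.sym tp≡s) (cong t (≡.sym (≡ᵇ⇒≡ j p (subst T (≡.sym j≡ᵇp) _))))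

write-other : ∀ {A : Set} {t : ℕ → A} p s j → j ≢ p → write p s t j ≡ t j
write-other p s j j≢p with j ≡ᵇ p in j≡ᵇp
... | false = refl
... | true  = ⊥-elim (j≢p (≡ᵇ⇒≡ j p (subst T (≡.sym j≡ᵇp) _)))

readIn-end : ∀ w → readIn w (suc (length w)) ≡ rend
readIn-end []      = refl
readIn-end (_ ∷ w) = readIn-end w

readIn-sym : ∀ w i → i < length w → ∃ λ b → readIn w (suc i) ≡ sym b
readIn-sym (b ∷ w) zero    _         = b , refl
readIn-sym (_ ∷ w) (suc i) (s≤s i<n) = readIn-sym w i i<n

readIn-sym⇒< : ∀ w i {b} → readIn w (suc i) ≡ sym b → i < length w
readIn-sym⇒< (_ ∷ w) zero    _ = z<s
readIn-sym⇒< (_ ∷ w) (suc i) p = s≤s (readIn-sym⇒< w i p)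

readIn-suc≢lend : ∀ w i → readIn w (suc i) ≢ lend
readIn-suc≢lend (_ ∷ w) (suc i) p = readIn-suc≢lend w i p

moveIn-right : ∀ {n i} → i ≤ n → moveIn n right i ≡ suc i
moveIn-right i≤n = m≤n⇒m⊓n≡m (s≤s i≤n)

module _ (M : TM) (w : List Bool) where
  open TM M using (Q; Γ; δ)

  data HaltsWithin (B : ℕ) : Config Q Γ → Bool → Set where
    halts : ∀ {c b} → Config.wpos c ≤ B → step M w c ≡ inj₂ b → HaltsWithin B c b
    steps : ∀ {c c′ b} → Config.wpos c ≤ B → step M w c ≡ inj₁ c′ →
            HaltsWithin B c′ b → HaltsWithin B c b

  halts-by : ∀ {B b q i t p a x} → p ≤ B → readIn w i ≡ a → t p ≡ x → δ q a x ≡ halt b →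
             HaltsWithin B (config q i t p) b
  halts-by p≤B refl refl δ≡halt = halts p≤B (step≡ δ≡halt)
    where
    step≡ : ∀ {q i t p b} → δ q (readIn w i) (t p) ≡ halt b → step M w (config q i t p) ≡ inj₂ b
    step≡ δ≡halt rewrite δ≡halt = refl

  steps-by : ∀ {B b q i t p a x q′ s mi mw i′} → p ≤ B → readIn w i ≡ a → t p ≡ x →
             δ q a x ≡ go q′ s mi mw → moveIn (length w) mi i ≡ i′ →
             HaltsWithin B (config q′ i′ (write p s t) (moveW mw p)) b →
             HaltsWithin B (config q i t p) b
  steps-by p≤B refl refl δ≡go refl = steps p≤B (step≡ δ≡go)
    where
    step≡ : ∀ {q i t p q′ s mi mw} → δ q (readIn w i) (t p) ≡ go q′ s mi mw →
            step M w (config q i t p)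
              ≡ inj₁ (config q′ (moveIn (length w) mi i) (write p s t) (moveW mw p))
    step≡ δ≡go rewrite δ≡go = refl

  run-halted : ∀ t b → run M w t (inj₂ b) ≡ inj₂ b
  run-halted zero    b = refl
  run-halted (suc t) b = refl

  haltsWithin⇒run : ∀ {B c b} → HaltsWithin B c b → ∃ λ t → run M w t (inj₁ c) ≡ inj₂ b
  haltsWithin⇒run (halts _ step≡) = 1 , step≡
  haltsWithin⇒run (steps _ step≡ h) with t , run≡ ← haltsWithin⇒run h =
    suc t , trans (cong (run M w t) step≡) run≡

  haltsWithin⇒space : ∀ {B c b} → HaltsWithin B c b →
    ∀ t c′ → run M w t (inj₁ c) ≡ inj₁ c′ → Config.wpos c′ ≤ B
  haltsWithin⇒space (halts p≤B _)   zero _ refl = p≤B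
  haltsWithin⇒space (steps p≤B _ _) zero _ refl = p≤B
  haltsWithin⇒space (halts {b = b} _ step≡) (suc t) c′ run≡
    with () ← trans (≡.sym (trans (cong (run M w t) step≡) (run-halted t b))) run≡
  haltsWithin⇒space (steps _ step≡ h) (suc t) c′ run≡ =
    haltsWithin⇒space h t c′ (trans (cong (run M w t) (≡.sym step≡)) run≡)

decidesInLogSpace : ∀ M f c (B : List Bool → ℕ) → (∀ w → B w ≤ c * ⌊log₂ length w ⌋ + c) →
  (∀ w → HaltsWithin M w (B w) (initConfig M) (f w)) → DecidesInLogSpace M f
decidesInLogSpace M f c B B≤ halting =
  (λ w → haltsWithin⇒run M w (halting w)) ,
  c , λ w t c′ run≡ → ≤-trans (haltsWithin⇒space M w (halting w) t c′ run≡) (B≤ w)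

begins1ᵏ0 : ℕ → List Bool → Bool
begins1ᵏ0 zero    (false ∷ _) = true
begins1ᵏ0 (suc k) (true ∷ w)  = begins1ᵏ0 k w
begins1ᵏ0 _       _           = false

L : List Bool → Bool
L w = begins1ᵏ0 (bitLength (length w)) w

1ᵏ0++ : ℕ → List Bool → List Bool
1ᵏ0++ k v = replicate k true ++ false ∷ v

length-1ᵏ0++ : ∀ k v → length (1ᵏ0++ k v) ≡ k + suc (length v)
length-1ᵏ0++ zero    v = refl
length-1ᵏ0++ (suc k) v = cong suc (length-1ᵏ0++ k v)

length-1ᵏ0++-+ : ∀ k u v → length (1ᵏ0++ (k + u) v) ≡ length (1ᵏ0++ k v) + u
length-1ᵏ0++-+ k u v = begin
  length (1ᵏ0++ (k + u) v)  ≡⟨ length-1ᵏ0++ (k + u) v ⟩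
  k + u + suc (length v)    ≡⟨ +-assoc k u _ ⟩
  k + (u + suc (length v))  ≡⟨ cong (k +_) (+-comm u _) ⟩
  k + (suc (length v) + u)  ≡⟨ +-assoc k _ u ⟨
  k + suc (length v) + u    ≡⟨ cong (_+ u) (length-1ᵏ0++ k v) ⟨
  length (1ᵏ0++ k v) + u    ∎
  where open ≡-Reasoning

begins1ᵏ0-1ᵏ0++ : ∀ k v → begins1ᵏ0 k (1ᵏ0++ k v) ≡ true
begins1ᵏ0-1ᵏ0++ zero    v = refl
begins1ᵏ0-1ᵏ0++ (suc k) v = begins1ᵏ0-1ᵏ0++ k v

begins1ᵏ0⇒1ᵏ0++ : ∀ k w → begins1ᵏ0 k w ≡ true → ∃ λ v → w ≡ 1ᵏ0++ k v
begins1ᵏ0⇒1ᵏ0++ zero    (false ∷ w) _ = w , refl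
begins1ᵏ0⇒1ᵏ0++ (suc k) (true ∷ w)  p with v , refl ← begins1ᵏ0⇒1ᵏ0++ k w p = v , refl

begins1ᵏ0-1ᵏ0++-unique : ∀ k j v → begins1ᵏ0 k (1ᵏ0++ j v) ≡ true → k ≡ j
begins1ᵏ0-1ᵏ0++-unique zero    zero    v _ = refl
begins1ᵏ0-1ᵏ0++-unique (suc k) (suc j) v p = cong suc (begins1ᵏ0-1ᵏ0++-unique k j v p)

L-wordOfLength : ∀ n → 3 ≤ n → ∃ λ w → length w ≡ n × L w ≡ true
L-wordOfLength n 3≤n = w , length≡n ,
  subst (λ l → begins1ᵏ0 (bitLength l) w ≡ true) (≡.sym length≡n) (begins1ᵏ0-1ᵏ0++ k _)
  where
  k = bitLength n
  m = n ∸ suc k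
  w = 1ᵏ0++ k (replicate m false)
  length≡n : length w ≡ n
  length≡n = begin
    length w                             ≡⟨ length-1ᵏ0++ k (replicate m false) ⟩
    k + suc (length (replicate m false)) ≡⟨ cong (λ l → k + suc l) (length-replicate m) ⟩
    k + suc m                            ≡⟨ +-suc k m ⟩
    suc k + m                            ≡⟨ m+[n∸m]≡n (bitLength<n n 3≤n) ⟩
    n                                    ∎
    where open ≡-Reasoning

L-infinite : Infinite (λ w → L w ≡ true)
L-infinite N with w , length≡ , w∈L ← L-wordOfLength (N + 3) (m≤n+m 3 N) =
  w , subst (N ≤_) (≡.sym length≡) (m≤m+n N 3) , w∈L

-- p-density

countLen-begins1ᵏ0 : ∀ k m → countLen (begins1ᵏ0 k) (suc k + m) ≡ 2 ^ m
countLen-begins1ᵏ0 zero    m = begin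
  countLen (begins1ᵏ0 0) (suc m)
    ≡⟨ countLen-suc _ m ⟩
  countLen (λ _ → true) m + countLen (λ _ → false) m
    ≡⟨ cong₂ _+_ (countLen-true m) (countLen-false m) ⟩
  2 ^ m + 0
    ≡⟨ +-identityʳ (2 ^ m) ⟩
  2 ^ m ∎
  where open ≡-Reasoning
countLen-begins1ᵏ0 (suc k) m = begin
  countLen (begins1ᵏ0 (suc k)) (suc l)
    ≡⟨ countLen-suc _ l ⟩
  countLen (λ _ → false) l + countLen (begins1ᵏ0 k) l
    ≡⟨ cong (_+ countLen (begins1ᵏ0 k) l) (countLen-false l) ⟩
  countLen (begins1ᵏ0 k) l
    ≡⟨ countLen-begins1ᵏ0 k m ⟩
  2 ^ m ∎
  where
  open ≡-Reasoning
  l = suc k + m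

countLen-L : ∀ n → bitLength n < n → countLen L n * 2 ^ suc (bitLength n) ≡ 2 ^ n
countLen-L n k<n = begin
  countLen L n * 2 ^ suc k
    ≡⟨ cong (_* 2 ^ suc k) (countLen-cong n λ w p → cong (λ l → begins1ᵏ0 (bitLength l) w) p) ⟩
  countLen (begins1ᵏ0 k) n * 2 ^ suc k
    ≡⟨ cong (λ l → countLen (begins1ᵏ0 k) l * 2 ^ suc k) n≡ ⟨
  countLen (begins1ᵏ0 k) (suc k + m) * 2 ^ suc k
    ≡⟨ cong (_* 2 ^ suc k) (countLen-begins1ᵏ0 k m) ⟩
  2 ^ m * 2 ^ suc k
    ≡⟨ *-comm (2 ^ m) (2 ^ suc k) ⟩
  2 ^ suc k * 2 ^ m
    ≡⟨ ^-distribˡ-+-* 2 (suc k) m ⟨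
  2 ^ (suc k + m)
    ≡⟨ cong (2 ^_) n≡ ⟩
  2 ^ n ∎
  where
  open ≡-Reasoning
  k = bitLength n
  m = n ∸ suc k
  n≡ : suc k + m ≡ n
  n≡ = m+[n∸m]≡n k<n

L-pDense : PDense L
L-pDense = 3 , 0 ∷ 4 ∷ [] , there (here λ ()) , bound
  where
  evalPoly-4x : ∀ n → 2 * (2 * n) ≡ 0 + n * (4 + n * 0)
  evalPoly-4x = solve-∀
  bound : ∀ n → 3 ≤ n → 2 ^ n ≤ countLen L n * evalPoly (0 ∷ 4 ∷ []) n
  bound n@(suc _) 3≤n = begin
    2 ^ n
      ≡⟨ countLen-L n (bitLength<n n 3≤n) ⟨
    countLen L n * (2 * 2 ^ bitLength n)
      ≤⟨ *-monoʳ-≤ (countLen L n) (*-monoʳ-≤ 2 (2^bitLength≤2*n n)) ⟩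
    countLen L n * (2 * (2 * n))
      ≡⟨ cong (countLen L n *_) (evalPoly-4x n) ⟩
    countLen L n * evalPoly (0 ∷ 4 ∷ []) n ∎
    where open ≤-Reasoning

-- Advice and a context-free grammar

-- Advice symbols: 𝟏 and 𝟎 demand the input symbol 1 resp. 0 at their position, ⋆ leaves it free.
pattern ⋆ = zero
pattern 𝟏 = suc zero
pattern 𝟎 = suc (suc zero)

advice : ℕ → ℕ → List (Fin 3)
advice zero    _       = []
advice (suc n) (suc k) = 𝟏 ∷ advice n k
advice (suc n) zero    = 𝟎 ∷ replicate n ⋆

length-advice : ∀ n k → length (advice n k) ≡ n
length-advice zero    _       = refl
length-advice (suc n) (suc k) = cong suc (length-advice n k)
length-advice (suc n) zero    = cong suc (length-replicate n)

unconstrained : List (Bool × Fin 3) → Bool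
unconstrained []             = true
unconstrained ((_ , ⋆) ∷ ws) = unconstrained ws
unconstrained _              = false

matchesAdvice : List (Bool × Fin 3) → Bool
matchesAdvice ((true , 𝟏) ∷ ws)  = matchesAdvice ws
matchesAdvice ((false , 𝟎) ∷ ws) = unconstrained ws
matchesAdvice _                  = false

unconstrained-zip-⋆ : ∀ x → unconstrained (zip x (replicate (length x) ⋆)) ≡ true
unconstrained-zip-⋆ []      = refl
unconstrained-zip-⋆ (_ ∷ x) = unconstrained-zip-⋆ x

begins1ᵏ0≡matchesAdvice : ∀ k x → begins1ᵏ0 k x ≡ matchesAdvice (zip x (advice (length x) k))
begins1ᵏ0≡matchesAdvice zero    []          = refl
begins1ᵏ0≡matchesAdvice (suc k) []          = refl
begins1ᵏ0≡matchesAdvice zero    (false ∷ x) = ≡.sym (unconstrained-zip-⋆ x)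
begins1ᵏ0≡matchesAdvice zero    (true ∷ x)  = refl
begins1ᵏ0≡matchesAdvice (suc k) (false ∷ x) = refl
begins1ᵏ0≡matchesAdvice (suc k) (true ∷ x)  = begins1ᵏ0≡matchesAdvice k x

pattern S = zero
pattern U = suc zero

adviceGrammar : CFG (Bool × Fin 3)
adviceGrammar = record
  { N     = 2
  ; start = S
  ; rules = (S , inj₂ (true , 𝟏) ∷ inj₁ S ∷ [])
          ∷ (S , inj₂ (false , 𝟎) ∷ inj₁ U ∷ [])
          ∷ (U , inj₂ (false , ⋆) ∷ inj₁ U ∷ [])
          ∷ (U , inj₂ (true , ⋆) ∷ inj₁ U ∷ [])
          ∷ (U , [])
          ∷ []
  }

Derives : Fin 2 → List (Bool × Fin 3) → Set
Derives X = DerivesSeq adviceGrammar (inj₁ X ∷ [])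

derives-by : ∀ {X β u} → (X , β) ∈ CFG.rules adviceGrammar →
  DerivesSeq adviceGrammar β u → Derives X u
derives-by {u = u} rule β⇒u = subst (Derives _) (++-identityʳ u) (nonterm rule β⇒u [])

unconstrained⇒U : ∀ ws → unconstrained ws ≡ true → Derives U ws
unconstrained⇒U []                 _ =
  derives-by (there (there (there (there (here refl))))) []
unconstrained⇒U ((false , ⋆) ∷ ws) p =
  derives-by (there (there (here refl))) (term _ (unconstrained⇒U ws p))
unconstrained⇒U ((true , ⋆) ∷ ws)  p =
  derives-by (there (there (there (here refl)))) (term _ (unconstrained⇒U ws p))

matchesAdvice⇒S : ∀ ws → matchesAdvice ws ≡ true → Derives S ws
matchesAdvice⇒S ((true , 𝟏) ∷ ws)  p = derives-by (here refl) (term _ (matchesAdvice⇒S ws p))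
matchesAdvice⇒S ((false , 𝟎) ∷ ws) p = derives-by (there (here refl)) (term _ (unconstrained⇒U ws p))

U⇒unconstrained : ∀ {ws} → Derives U ws → unconstrained ws ≡ true
U⇒unconstrained (nonterm {u = u} rule β⇒u []) rewrite ++-identityʳ u = byRule rule β⇒u
  where
  byRule : ∀ {β u} → (U , β) ∈ CFG.rules adviceGrammar → DerivesSeq adviceGrammar β u →
           unconstrained u ≡ true
  byRule (there (there (here refl)))                 (term _ U⇒u) = U⇒unconstrained U⇒u
  byRule (there (there (there (here refl))))         (term _ U⇒u) = U⇒unconstrained U⇒u
  byRule (there (there (there (there (here refl))))) []           = refl

S⇒matchesAdvice : ∀ {ws} → Derives S ws → matchesAdvice ws ≡ true
S⇒matchesAdvice (nonterm {u = u} rule β⇒u []) rewrite ++-identityʳ u = byRule rule β⇒u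
  where
  byRule : ∀ {β u} → (S , β) ∈ CFG.rules adviceGrammar → DerivesSeq adviceGrammar β u →
           matchesAdvice u ≡ true
  byRule (here refl)         (term _ S⇒u) = S⇒matchesAdvice S⇒u
  byRule (there (here refl)) (term _ U⇒u) = U⇒unconstrained U⇒u
  byRule (there (there (here ())))
  byRule (there (there (there (here ()))))
  byRule (there (there (there (there (here ())))))

L-inCFLn : InCFLn (λ w → L w ≡ true)
L-inCFLn = 3 , h , (λ n → length-advice n (bitLength n)) , Generates adviceGrammar ,
           (adviceGrammar , λ _ → mk⇔ (λ d → d) (λ d → d)) ,
           λ x → mk⇔ (λ p → matchesAdvice⇒S _ (trans (≡.sym (begins1ᵏ0≡matchesAdvice _ x)) p))
                     (λ d → trans (begins1ᵏ0≡matchesAdvice _ x) (S⇒matchesAdvice d))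
  where
  h : ℕ → List (Fin 3)
  h n = advice n (bitLength n)

-- REG-immunity

pumped∉L : ∀ k v u → 1 ≤ k → 3 ≤ u → length (1ᵏ0++ k v) ≤ u → L (1ᵏ0++ (k + u) v) ≢ true
pumped∉L k v u 1≤k 3≤u n≤u pumped∈L = <⇒≱ (begin-strict
  u                  <⟨ m<n+m u 1≤k ⟩
  k + u              ≡⟨ begins1ᵏ0-1ᵏ0++-unique _ (k + u) v begins ⟨
  bitLength (n + u)  ∎) (bitLength[n+u]≤u n u 3≤u n≤u)
  where
  open ≤-Reasoning
  n = length (1ᵏ0++ k v)
  begins : begins1ᵏ0 (bitLength (n + u)) (1ᵏ0++ (k + u) v) ≡ true
  begins = subst (λ l → begins1ᵏ0 (bitLength l) (1ᵏ0++ (k + u) v) ≡ true)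
                 (length-1ᵏ0++-+ k u v) pumped∈L

L-regularSubset-finite : (R : List Bool → Set) → Regular R → (∀ w → R w → L w ≡ true) →
  ¬ Infinite R
L-regularSubset-finite R (D , R⇔D) R⊆L R-infinite
  with w , 2^Q≤n , Rw ← R-infinite (2 ^ DFA.Q D)
  with v , w≡ ← begins1ᵏ0⇒1ᵏ0++ (bitLength (length w)) w (R⊆L w Rw)
  with d , pump ← runDFA-pump D true (DFA.start D)
  = pumped∉L k v u (≤-trans z<s Q<k) 3≤u n≤u (R⊆L w′ Rw′)
  where
  open ≡-Reasoning
  k = bitLength (length w)
  n = length (1ᵏ0++ k v)
  u = (n + 3) * suc d
  w′ = 1ᵏ0++ (k + u) v
  Q<k : DFA.Q D < k
  Q<k = 2^k≤n⇒k<bitLength 2^Q≤n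
  n+3≤u : n + 3 ≤ u
  n+3≤u = m≤m*n (n + 3) (suc d)
  3≤u = ≤-trans (m≤n+m 3 n) n+3≤u
  n≤u = ≤-trans (m≤m+n n 3) n+3≤u
  same-state : runDFA D (DFA.start D) w′ ≡ runDFA D (DFA.start D) w
  same-state = begin
    runDFA D s w′
      ≡⟨ runDFA-++ D s (replicate (k + u) true) _ ⟩
    runDFA D (runDFA D s (replicate (k + u) true)) (false ∷ v)
      ≡⟨ cong (λ q → runDFA D q (false ∷ v)) (pump k (n + 3) (<⇒≤ Q<k)) ⟩
    runDFA D (runDFA D s (replicate k true)) (false ∷ v)
      ≡⟨ runDFA-++ D s (replicate k true) _ ⟨
    runDFA D s (1ᵏ0++ k v)
      ≡⟨ cong (runDFA D s) w≡ ⟨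
    runDFA D s w ∎
    where s = DFA.start D
  Rw′ : R w′
  Rw′ = Equivalence.from (R⇔D w′)
          (trans (cong (DFA.accept D) same-state) (Equivalence.to (R⇔D w) Rw))

L-REGImmune : REGImmune (λ w → L w ≡ true)
L-REGImmune = L-infinite , L-regularSubset-finite

-- A log-space machine for L

replicate-++-∷ : ∀ {A : Set} j (x : A) rest → replicate j x ++ x ∷ rest ≡ replicate (suc j) x ++ rest
replicate-++-∷ zero    x rest = refl
replicate-++-∷ (suc j) x rest = cong (x ∷_) (replicate-++-∷ j x rest)

≤-length-replicate-++ : ∀ {A : Set} j (x : A) rest → j ≤ length (replicate j x ++ rest)
≤-length-replicate-++ zero    x rest = z≤n
≤-length-replicate-++ (suc j) x rest = s≤s (≤-length-replicate-++ j x rest)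

pattern blank = zero
pattern mark  = suc zero
pattern bit0  = suc (suc zero)
pattern bit1  = suc (suc (suc zero))

pattern start  = zero
pattern count  = suc zero
pattern carry  = suc (suc zero)
pattern return = suc (suc (suc zero))
pattern rewind = suc (suc (suc (suc zero)))
pattern check  = suc (suc (suc (suc (suc zero))))

-- Cell 0 of the work tape holds a marker, cells 1, 2, … a little-endian binary counter.  For each
-- input symbol the counter is incremented (carry) and the work head sent back to cell 1 (return);
-- at the right endmarker the input head goes back to the left end (rewind) and the input is
-- checked to start with one 1 per counter digit followed by a 0.
δ : Fin 6 → InSym → Fin 4 → Action 6 3
δ start  _           _     = go count mark right right
δ count  rend        x     = go rewind x left stay
δ count  _           x     = go carry x stay stay
δ carry  _           bit1  = go carry bit0 stay right
δ carry  _           _     = go return bit1 right left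
δ return _           mark  = go count mark stay right
δ return _           x     = go return x stay left
δ rewind lend        x     = go check x right stay
δ rewind _           x     = go rewind x left stay
δ check  (sym true)  bit0  = go check bit0 right right
δ check  (sym true)  bit1  = go check bit1 right right
δ check  (sym false) blank = halt true
δ check  _           _     = halt false

M : TM
M = record { Q = 6 ; Γ = 3 ; start = start ; δ = δ }

digit : Bool → Fin 4
digit false = bit0
digit true  = bit1

δ-return-digit : ∀ a c → δ return a (digit c) ≡ go return (digit c) stay left
δ-return-digit a false = refl
δ-return-digit a true  = refl

δ-check-digit : ∀ c → δ check (sym true) (digit c) ≡ go check (digit c) right right
δ-check-digit false = refl
δ-check-digit true  = refl

δ-rewind : ∀ a x → a ≢ lend → δ rewind a x ≡ go rewind x left stay
δ-rewind lend    x a≢lend = ⊥-elim (a≢lend refl)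
δ-rewind rend    x _      = refl
δ-rewind (sym _) x _      = refl

cell : List Bool → ℕ → Fin 4
cell []       _       = blank
cell (b ∷ _)  zero    = digit b
cell (_ ∷ ds) (suc k) = cell ds k

cell-replicate-++ : ∀ j (x : Bool) rest → cell (replicate j x ++ rest) j ≡ cell rest 0
cell-replicate-++ zero    x rest = refl
cell-replicate-++ (suc j) x rest = cell-replicate-++ j x rest

cell-digit : ∀ ds k → k < length ds → ∃ λ b → cell ds k ≡ digit b
cell-digit (b ∷ ds) zero    _         = b , refl
cell-digit (_ ∷ ds) (suc k) (s≤s k<l) = cell-digit ds k k<l

cell-write : ∀ j (x c : Bool) rest k →
  write j (digit c) (cell (replicate j x ++ rest)) k ≡ cell (replicate j x ++ c ∷ drop 1 rest) k
cell-write zero    x c rest    zero    = refl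
cell-write zero    x c []      (suc k) = refl
cell-write zero    x c (_ ∷ _) (suc k) = refl
cell-write (suc j) x c rest    zero    = refl
cell-write (suc j) x c rest    (suc k) = cell-write j x c rest k

record Stores (t : ℕ → Fin 4) (ds : List Bool) : Set where
  field
    marker : t 0 ≡ mark
    digits : ∀ k → t (suc k) ≡ cell ds k
open Stores

stores-write-same : ∀ {t ds} p {s} → t p ≡ s → Stores t ds → Stores (write p s t) ds
stores-write-same {t} p tp≡s st = record
  { marker = trans (write-same {t = t} p tp≡s 0) (marker st)
  ; digits = λ k → trans (write-same {t = t} p tp≡s (suc k)) (digits st k)
  }

stores-write : ∀ {t} j (x c : Bool) rest → Stores t (replicate j x ++ rest) →
  Stores (write (suc j) (digit c) t) (replicate j x ++ c ∷ drop 1 rest)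
stores-write j x c rest st = record
  { marker = marker st
  ; digits = λ k → trans (cong (λ y → if k ≡ᵇ j then digit c else y) (digits st k))
                         (cell-write j x c rest k)
  }

module _ (w : List Bool) where
  private
    n B : ℕ
    n = length w
    B = suc (bitLength n)

    Halts : Config 6 3 → Bool → Set
    Halts = HaltsWithin M w B

    CountsOn : ℕ → List Bool → Bool → Set
    CountsOn i ds b = ∀ t → Stores t ds → Halts (config count i t 1) b

  check-position : ∀ {j l} → j + l ≡ bitLength n → suc j ≤ B
  check-position {j} {l} j+l≡ = s≤s (subst (j ≤_) j+l≡ (m≤m+n j l))

  check-stops : ∀ {j l t a x b} → j + l ≡ bitLength n → readIn w (suc j) ≡ a → t (suc j) ≡ x →
    δ check a x ≡ halt b → Halts (config check (suc j) t (suc j)) b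
  check-stops j+l≡ = halts-by M w (check-position j+l≡)

  check-halts : ∀ j ds rest t → j + length ds ≡ bitLength n →
    (∀ k → t (suc (k + j)) ≡ cell ds k) → (∀ k → readIn w (suc (k + j)) ≡ readIn rest (suc k)) →
    Halts (config check (suc j) t (suc j)) (begins1ᵏ0 (length ds) rest)
  check-halts j []          []          t j+l≡ tape input = check-stops j+l≡ (input 0) (tape 0) refl
  check-halts j (_ ∷ _)     []          t j+l≡ tape input = check-stops j+l≡ (input 0) (tape 0) refl
  check-halts j []          (false ∷ _) t j+l≡ tape input = check-stops j+l≡ (input 0) (tape 0) refl
  check-halts j []          (true ∷ _)  t j+l≡ tape input = check-stops j+l≡ (input 0) (tape 0) refl
  check-halts j (false ∷ _) (false ∷ _) t j+l≡ tape input = check-stops j+l≡ (input 0) (tape 0) refl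
  check-halts j (true ∷ _)  (false ∷ _) t j+l≡ tape input = check-stops j+l≡ (input 0) (tape 0) refl
  check-halts j (c ∷ ds)    (true ∷ r)  t j+l≡ tape input =
    steps-by M w (check-position j+l≡) (input 0) (tape 0) (δ-check-digit c)
      (moveIn-right (readIn-sym⇒< w j (input 0)))
      (check-halts (suc j) ds r _ (trans (≡.sym (+-suc j (length ds))) j+l≡) tape′ input′)
    where
    tape′ : ∀ k → write (suc j) (digit c) t (suc (k + suc j)) ≡ cell ds k
    tape′ k = begin
      write (suc j) (digit c) t (suc (k + suc j))
        ≡⟨ write-other {t = t} (suc j) (digit c) _ (m+1+n≢n k ∘ suc-injective) ⟩
      t (suc (k + suc j))
        ≡⟨ cong (λ m → t (suc m)) (+-suc k j) ⟩
      t (suc (suc k + j))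
        ≡⟨ tape (suc k) ⟩
      cell ds k ∎
      where open ≡-Reasoning
    input′ : ∀ k → readIn w (suc (k + suc j)) ≡ readIn r (suc k)
    input′ k = trans (cong (λ m → readIn w (suc m)) (+-suc k j)) (input (suc k))

  check-from-start : ∀ t → Stores t (binary n) → Halts (config check 1 t 1) (L w)
  check-from-start t st = check-halts 0 (binary n) w t refl
    (λ k → trans (cong (λ m → t (suc m)) (+-identityʳ k)) (digits st k))
    (λ k → cong (λ m → readIn w (suc m)) (+-identityʳ k))

  rewind-halts : ∀ p t → Stores t (binary n) → Halts (config rewind p t 1) (L w)
  rewind-halts zero    t st = steps-by M w (s≤s z≤n) refl refl refl refl
    (check-from-start _ (stores-write-same 1 refl st))
  rewind-halts (suc p) t st =
    steps-by M w (s≤s z≤n) refl refl (δ-rewind _ (t 1) (readIn-suc≢lend w p)) refl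
      (rewind-halts p _ (stores-write-same 1 refl st))

  return-halts : ∀ {b i ds} → length ds ≤ bitLength n → CountsOn i ds b →
    ∀ p t → p ≤ length ds → Stores t ds → Halts (config return i t p) b
  return-halts _ continue zero t _ st =
    steps-by M w z≤n refl (marker st) refl refl (continue _ (stores-write-same 0 (marker st) st))
  return-halts {ds = ds} l≤ continue (suc p) t p<l st
    with c , cell≡digit ← cell-digit ds p p<l =
    steps-by M w (s≤s (≤-trans (<⇒≤ p<l) l≤)) refl t≡digit (δ-return-digit _ c) refl
      (return-halts l≤ continue p _ (<⇒≤ p<l) (stores-write-same (suc p) t≡digit st))
    where
    t≡digit : t (suc p) ≡ digit c
    t≡digit = trans (digits st p) cell≡digit

  carry-position : ∀ i j rest → i ≤ n → binary i ≡ replicate j true ++ rest → suc j ≤ B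
  carry-position i j rest i≤n binary≡ = s≤s (≤-trans j≤ (bitLength-mono i≤n))
    where
    j≤ : j ≤ length (binary i)
    j≤ = subst (λ ds → j ≤ length ds) (≡.sym binary≡) (≤-length-replicate-++ j true rest)

  carry-stops : ∀ {b} i → i < n → CountsOn (suc (suc i)) (binary (suc i)) b →
    ∀ j rest t → binary i ≡ replicate j true ++ rest →
    δ carry (readIn w (suc i)) (cell rest 0) ≡ go return bit1 right left →
    increment rest ≡ true ∷ drop 1 rest → Stores t (replicate j false ++ rest) →
    Halts (config carry (suc i) t (suc j)) b
  carry-stops i i<n continue j rest t binary≡ δ≡ increment≡ st =
    steps-by M w (carry-position i j rest (<⇒≤ i<n) binary≡) refl
      (trans (digits st j) (cell-replicate-++ j false rest)) δ≡ (moveIn-right i<n)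
      (return-halts (bitLength-mono i<n) continue j _ j≤
        (subst (Stores _) (≡.sym binary≡′) (stores-write j false true rest st)))
    where
    binary≡′ : binary (suc i) ≡ replicate j false ++ true ∷ drop 1 rest
    binary≡′ = trans (cong increment binary≡)
      (trans (increment-replicate-++ j rest) (cong (replicate j false ++_) increment≡))
    j≤ : j ≤ length (binary (suc i))
    j≤ = subst (λ ds → j ≤ length ds) (≡.sym binary≡′) (≤-length-replicate-++ j false _)

  carry-halts : ∀ {b} i → i < n → CountsOn (suc (suc i)) (binary (suc i)) b →
    ∀ j rest t → binary i ≡ replicate j true ++ rest → Stores t (replicate j false ++ rest) →
    Halts (config carry (suc i) t (suc j)) b
  carry-halts i i<n continue j []          t binary≡ st =
    carry-stops i i<n continue j [] t binary≡ refl refl st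
  carry-halts i i<n continue j (false ∷ r) t binary≡ st =
    carry-stops i i<n continue j (false ∷ r) t binary≡ refl refl st
  carry-halts i i<n continue j (true ∷ r)  t binary≡ st =
    steps-by M w (carry-position i j (true ∷ r) (<⇒≤ i<n) binary≡) refl
      (trans (digits st j) (cell-replicate-++ j false (true ∷ r))) refl refl
      (carry-halts i i<n continue (suc j) r _ (trans binary≡ (replicate-++-∷ j true r))
        (subst (Stores _) (replicate-++-∷ j false r) (stores-write j false false (true ∷ r) st)))

  count-halts : ∀ k i → i + k ≡ n → CountsOn (suc i) (binary i) (L w)
  count-halts zero i i+0≡n t st with refl ← trans (≡.sym (+-identityʳ i)) i+0≡n =
    steps-by M w (s≤s z≤n) (readIn-end w) refl refl refl
      (rewind-halts n _ (stores-write-same 1 refl st))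
  count-halts (suc k) i i+k≡n t st = count-step (readIn-sym w i i<n)
    where
    i<n : i < n
    i<n = subst (i <_) i+k≡n (m<m+n i z<s)
    count-step : ∃ (λ b → readIn w (suc i) ≡ sym b) → Halts (config count (suc i) t 1) (L w)
    count-step (_ , readIn≡sym) = steps-by M w (s≤s z≤n) readIn≡sym refl refl refl
      (carry-halts i i<n (count-halts k (suc i) (trans (≡.sym (+-suc i k)) i+k≡n)) 0 (binary i) _
        refl (stores-write-same 1 refl st))

  M-halts : Halts (initConfig M) (L w)
  M-halts = steps-by M w z≤n refl refl refl refl
    (count-halts n 0 refl _ (record { marker = refl ; digits = λ _ → refl }))

L-inLOGSPACE : InLOGSPACE L
L-inLOGSPACE = M , decidesInLogSpace M L 2 (λ w → suc (bitLength (length w)))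
                     (λ w → 1+bitLength≤2*⌊log₂⌋+2 (length w)) M-halts

proposition3p4 : Σ (List Bool → Bool) λ L →
    InLOGSPACE L × InCFLn (λ w → L w ≡ true) × PDense L × REGImmune (λ w → L w ≡ true)
proposition3p4 = L , L-inLOGSPACE , L-inCFLn , L-pDense , L-REGImmune
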